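{- Let $\mathcal{P}$ be a meager recurrent $k$-ary processor satisfying $f_{\mathcal{P}}(\mathbf{x}+\lambda_k \mathbf{e}_k) = f_{\mathcal{P}}(\mathbf{x})+1$. Then $\mathcal{P}$ can be emulated by a network of a recurrent $(k{ - }1)$-ary processor, a $\lambda_k$-toppler, and an adder.
   Context: An abelian processor with input alphabet $A$, output alphabet $B$ and finite state space $Q$ consists of transition maps $t_i:Q\to Q$ and output maps $o_i:Q\to\mathbb{N}^B$ ($i\in A$) with $t_it_j=t_jt_i$ and $o_i+o_jt_i=o_j+o_it_j$, and a starting state from which all states are reachable; it computes $f_{\mathcal{P}}:\mathbb{N}^A\to\mathbb{N}^B$, the total output after inputting $x_a$ letters $a$ for each $a$. It is $k$-ary if it has $k$ input letters; here it has unary output, so $f_{\mathcal{P}}:\mathbb{N}^k\to\mathbb{N}$. It is recurrent if every state can be reached from every other state by some input. A recurrent $k$-ary processor computes $f(\mathbf{x})=\mathbf{b}\cdot\mathbf{x}+P(\mathbf{x})$ with $P$ periodic modulo a finite-index lattice $\Lambda\subset\mathbb{Z}^k$; $\lambda_k$ is the smallest positive integer with $\lambda_k\mathbf{e}_k\in\Lambda$. The processor is meager if $f_{\mathcal{P}}(\lambda_k\mathbf{e}_k)=1$. A $\lambda$-toppler has states $0,\dots,\lambda-1$, moves from $q$ to $q+1$ emitting nothing when $q<\lambda-1$, and from $\lambda-1$ to $0$ emitting one letter (it may be started in any state, i.e. primed). An adder emits one letter for each letter received on either of its two inputs. A network emulates a processor if it computes the same function. -}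

module Defs where

open import Data.Nat using (ℕ; zero; suc; _+_; _*_; _<_; _≡ᵇ_; _%_)
open import Data.Nat.DivMod using (m%n<n)
open import Data.Fin using (Fin; zero; suc; toℕ; fromℕ; fromℕ<; inject₁)
open import Data.Fin.Properties using (_≟_)
open import Data.List using (List; []; _∷_; replicate; concatMap; allFin)
open import Data.Bool using (if_then_else_)
open import Data.Product using (∃; _×_)
open import Relation.Nullary using (¬_)
open import Relation.Nullary.Decidable using (⌊_⌋)
open import Relation.Binary.PropositionalEquality using (_≡_)

-- A (raw) processor with input alphabet Fin k and unary output:
-- finite state space Fin states, transition maps t_i and output maps o_i.

record Machine (k : ℕ) : Set where
  field
    states : ℕ
    trans  : Fin k → Fin states → Fin states
    out    : Fin k → Fin states → ℕ

module _ {k : ℕ} (M : Machine k) where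
  open Machine M

  runState : Fin states → List (Fin k) → Fin states
  runState q []      = q
  runState q (a ∷ w) = runState (trans a q) w

  runOut : Fin states → List (Fin k) → ℕ
  runOut q []      = 0
  runOut q (a ∷ w) = out a q + runOut (trans a q) w

wordOf : {k : ℕ} → (Fin k → ℕ) → List (Fin k)
wordOf {k} x = concatMap (λ a → replicate (x a) a) (allFin k)

computes : {k : ℕ} (M : Machine k) → Fin (Machine.states M) → (Fin k → ℕ) → ℕ
computes M q x = runOut M q (wordOf x)

record AbelianProcessor (k : ℕ) : Set where
  field
    machine : Machine k
    start   : Fin (Machine.states machine)
    comm    : ∀ i j q → Machine.trans machine i (Machine.trans machine j q)
                        ≡ Machine.trans machine j (Machine.trans machine i q)
    outComm : ∀ i j q → Machine.out machine i q + Machine.out machine j (Machine.trans machine i q)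
                        ≡ Machine.out machine j q + Machine.out machine i (Machine.trans machine j q)
    reach   : ∀ q → ∃ λ (w : List (Fin k)) → runState machine start w ≡ q

fP : {k : ℕ} → AbelianProcessor k → (Fin k → ℕ) → ℕ
fP P = computes (AbelianProcessor.machine P) (AbelianProcessor.start P)

Recurrent : {k : ℕ} → AbelianProcessor k → Set
Recurrent {k} P = ∀ q q' → ∃ λ (w : List (Fin k)) → runState (AbelianProcessor.machine P) q w ≡ q'

unitVec : {k : ℕ} → Fin k → Fin k → ℕ
unitVec j i = if ⌊ i ≟ j ⌋ then 1 else 0

scaledUnit : {k : ℕ} → ℕ → Fin k → Fin k → ℕ
scaledUnit c j i = c * unitVec j i

addScaledUnit : {k : ℕ} → (Fin k → ℕ) → ℕ → Fin k → Fin k → ℕ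
addScaledUnit x c j i = x i + scaledUnit c j i

-- λ_k for a recurrent (suc m)-ary processor: the lattice Λ is the set of
-- input vectors acting trivially on the states; λ_k is the least positive
-- λ with λ e_k ∈ Λ, i.e. t_k^λ = id.  Here e_k = the last letter fromℕ m.

ActsTrivially : {m : ℕ} → AbelianProcessor (suc m) → ℕ → Set
ActsTrivially {m} P c =
  ∀ q → runState (AbelianProcessor.machine P) q (replicate c (fromℕ m)) ≡ q

IsLambdaK : {m : ℕ} → AbelianProcessor (suc m) → ℕ → Set
IsLambdaK P c = (0 < c) × ActsTrivially P c × (∀ d → 0 < d → d < c → ¬ ActsTrivially P d)

Meager : {m : ℕ} → AbelianProcessor (suc m) → ℕ → Set
Meager {m} P c = fP P (scaledUnit c (fromℕ m)) ≡ 1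

-- λ-toppler (λ = suc l): states 0..l, q ↦ q+1 emitting nothing for q < l,
-- l ↦ 0 emitting one letter.

toppler : ℕ → Machine 1
toppler l = record
  { states = suc l
  ; trans  = λ _ q → fromℕ< (m%n<n (suc (toℕ q)) (suc l))
  ; out    = λ _ q → if toℕ q ≡ᵇ l then 1 else 0
  }

adder : Machine 2
adder = record
  { states = 1
  ; trans  = λ _ q → q
  ; out    = λ _ _ → 1
  }

pair : ℕ → ℕ → Fin 2 → ℕ
pair a b zero    = a
pair a b (suc _) = b

-- The network: inputs 1..k-1 feed the (k-1)-ary processor Q; Q's output and
-- input k feed the two inputs of the adder; the adder's output feeds the
-- λ-toppler (primed in state s), whose output is the network output.
networkFun : {m : ℕ} → AbelianProcessor m → (l : ℕ) → Fin (suc l)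
             → (Fin (suc m) → ℕ) → ℕ
networkFun {m} Q l s x =
  computes (toppler l) s
    (λ _ → computes adder zero (pair (fP Q (λ i → x (inject₁ i))) (x (fromℕ m))))

module Submission where

-- Meagerness and reachability show that every state emits
-- exactly one letter on K^L, so the potential c(q) = Σ_{1≤j≤l} (output of K^j
-- from q) lies in [0, L) and one letter K raises L·(output) + c by exactly one.
-- The states of potential zero represent the K-orbits: rep q = (K^(L - c q)) q is
-- unchanged by K, and for every other letter i the excess L·o_i(q) + c(t_i q)
-- exceeds c(q) by an amount depending on rep q only.  The (k-1)-ary processor Q
-- lives on the representatives: i acts as rep ∘ t_i and emits that amount.
-- Integrating the one-letter balances along an input x = (x′, x_K) gives
--   L·f_P(x) + c(final state) = c(start) + f_Q(x′) + x_K,  c(final state) < L,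
-- so f_P(x) = ⌊(c(start) + f_Q(x′) + x_K)/L⌋: the output of the adder fed by Q and
-- x_K, passed through the L-toppler primed in state c(start).
-- The file first proves the general tools (division, words of vectors, tally and
-- toppler, conservation laws along words, enumerating a subset of Fin N, moving a
-- letter past a word), then builds c, rep and Q in the module LastLetter.

open import Defs
open import Data.Nat using (ℕ; suc; _+_)
open import Data.Fin using (Fin; fromℕ)
open import Data.Product using (Σ; ∃; _×_)
open import Relation.Binary.PropositionalEquality using (_≡_)

open import Function using (_∘_)
open import Data.Bool using (Bool; true; false; T; T?; if_then_else_)
open import Data.Unit using (tt)
open import Data.Empty using (⊥-elim)
open import Data.Product using (_,_; proj₁; proj₂)
open import Data.Nat using (zero; _*_; _∸_; _≤_; _<_; _≡ᵇ_; z≤n; s≤s; NonZero)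
open import Data.Nat.Properties
  using (+-assoc; +-comm; +-identityʳ; *-identityʳ; *-zeroʳ; *-comm; *-distribˡ-+;
         +-cancelˡ-≡; +-cancelʳ-≡; m≤m+n; +-mono-≤; ≤-trans; n≤1+n; <⇒≤; m+[n∸m]≡n;
         ≡ᵇ⇒≡; ≡⇒≡ᵇ; ≤∧≢⇒<; +-commutativeSemigroup; module ≤-Reasoning)
open import Data.Nat.DivMod using (_/_; _%_; m%n<n; n%n≡0; m<n⇒m%n≡m; m<n⇒m/n≡0; m*n/n≡m; +-distrib-/-∣ʳ)
open import Data.Nat.Divisibility using (divides-refl)
open import Data.Nat.Tactic.RingSolver using (solve)
open import Algebra.Properties.CommutativeSemigroup +-commutativeSemigroup using (interchange)
open import Data.Fin using (zero; suc; toℕ; fromℕ<; inject₁)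
open import Data.Fin.Properties using (toℕ<n; toℕ≤pred[n]; toℕ-fromℕ<; fromℕ≢inject₁)
  renaming (_≟_ to _≟ᶠ_)
open import Data.Fin.Relation.Unary.Top using (View; view; ‵fromℕ; ‵inject₁)
open import Data.List using (List; []; _∷_; _++_; [_]; map; replicate; concatMap; tabulate; _∷ʳ_; length)
open import Data.List.Properties
  using (++-identityʳ; length-++; length-replicate; map-replicate; map-tabulate;
         concatMap-++; concatMap-map; map-concatMap; concatMap-cong)
open import Relation.Nullary using (¬_; yes; no)
open import Relation.Nullary.Decidable using (isYes≗does; dec-false; dec-true)
open import Relation.Binary.PropositionalEquality
  using (refl; sym; trans; cong; cong₂; subst; module ≡-Reasoning)

div-exact : ∀ L .{{_ : NonZero L}} a r → r < L → (L * a + r) / L ≡ a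
div-exact L a r r<L = begin
  (L * a + r) / L       ≡⟨ cong (_/ L) (trans (+-comm (L * a) r) (cong (r +_) (*-comm L a))) ⟩
  (r + a * L) / L       ≡⟨ +-distrib-/-∣ʳ r (divides-refl a) ⟩
  r / L + a * L / L     ≡⟨ cong₂ _+_ (m<n⇒m/n≡0 r<L) (m*n/n≡m a L) ⟩
  a                     ∎
  where open ≡-Reasoning

quotient-unique : ∀ L .{{_ : NonZero L}} {a b r s} → r < L → s < L
                → L * a + r ≡ L * b + s → a ≡ b
quotient-unique L {a} {b} {r} {s} r<L s<L eq =
  trans (sym (div-exact L a r r<L)) (trans (cong (_/ L) eq) (div-exact L b s s<L))

realign : ∀ L E a b n u v → b + u ≡ L → a + v ≡ L → L * E + b ≡ a + n → n + u ≡ v + E * L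
realign L E a b n u v b+u≡L a+v≡L balance = +-cancelʳ-≡ a _ _ (begin
  n + u + a          ≡⟨ solve (n ∷ u ∷ a ∷ []) ⟩
  a + n + u          ≡⟨ cong (_+ u) (sym balance) ⟩
  L * E + b + u      ≡⟨ +-assoc (L * E) b u ⟩
  L * E + (b + u)    ≡⟨ cong (L * E +_) (trans b+u≡L (sym a+v≡L)) ⟩
  L * E + (a + v)    ≡⟨ solve (L ∷ E ∷ a ∷ v ∷ []) ⟩
  v + E * L + a      ∎)
  where open ≡-Reasoning

excess-balance : ∀ L o o′ E E′ x x′ y y′ n → o + E′ ≡ E + o′
  → L * E′ + x′ ≡ x + n → L * E + y′ ≡ y + n → L * o + x + y′ ≡ y + (L * o′ + x′)
excess-balance L o o′ E E′ x x′ y y′ n swap cons′ cons = +-cancelʳ-≡ n _ _ (begin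
  L * o + x + y′ + n            ≡⟨ solve (L ∷ o ∷ x ∷ y′ ∷ n ∷ []) ⟩
  L * o + (x + n) + y′          ≡⟨ cong (λ z → L * o + z + y′) (sym cons′) ⟩
  L * o + (L * E′ + x′) + y′    ≡⟨ solve (L ∷ o ∷ E′ ∷ x′ ∷ y′ ∷ []) ⟩
  L * (o + E′) + x′ + y′        ≡⟨ cong (λ z → L * z + x′ + y′) swap ⟩
  L * (E + o′) + x′ + y′        ≡⟨ solve (L ∷ E ∷ o′ ∷ x′ ∷ y′ ∷ []) ⟩
  L * E + y′ + (L * o′ + x′)    ≡⟨ cong (_+ (L * o′ + x′)) cons ⟩
  y + n + (L * o′ + x′)         ≡⟨ solve (y ∷ n ∷ L ∷ o′ ∷ x′ ∷ []) ⟩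
  y + (L * o′ + x′) + n         ∎)
  where open ≡-Reasoning

replicate-+ : ∀ {A : Set} a b (x : A) → replicate (a + b) x ≡ replicate a x ++ replicate b x
replicate-+ zero    b x = refl
replicate-+ (suc a) b x = cong (x ∷_) (replicate-+ a b x)

tabulate-last : ∀ {A : Set} n (f : Fin (suc n) → A)
              → tabulate f ≡ tabulate (f ∘ inject₁) ∷ʳ f (fromℕ n)
tabulate-last zero    f = refl
tabulate-last (suc n) f = cong (f zero ∷_) (tabulate-last n (f ∘ suc))

wordOf-split : ∀ m (x : Fin (suc m) → ℕ)
             → wordOf x ≡ map inject₁ (wordOf (x ∘ inject₁)) ++ replicate (x (fromℕ m)) (fromℕ m)
wordOf-split m x = begin
  concatMap block (tabulate (λ a → a))
    ≡⟨ cong (concatMap block) (tabulate-last m (λ a → a)) ⟩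
  concatMap block (tabulate inject₁ ++ [ fromℕ m ])
    ≡⟨ concatMap-++ block (tabulate inject₁) [ fromℕ m ] ⟩
  concatMap block (tabulate inject₁) ++ (block (fromℕ m) ++ [])
    ≡⟨ cong₂ _++_ firstBlocks (++-identityʳ (block (fromℕ m))) ⟩
  map inject₁ (wordOf (x ∘ inject₁)) ++ block (fromℕ m) ∎
  where
  open ≡-Reasoning
  block : Fin (suc m) → List (Fin (suc m))
  block a = replicate (x a) a
  firstBlocks : concatMap block (tabulate inject₁) ≡ map inject₁ (wordOf (x ∘ inject₁))
  firstBlocks = begin
    concatMap block (tabulate inject₁)
      ≡⟨ cong (concatMap block) (sym (map-tabulate (λ a → a) inject₁)) ⟩
    concatMap block (map inject₁ (tabulate (λ a → a)))
      ≡⟨ concatMap-map block inject₁ (tabulate (λ a → a)) ⟩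
    concatMap (block ∘ inject₁) (tabulate (λ a → a))
      ≡⟨ concatMap-cong (λ a → sym (map-replicate inject₁ (x (inject₁ a)) a)) (tabulate (λ a → a)) ⟩
    concatMap (map inject₁ ∘ (λ a → replicate (x (inject₁ a)) a)) (tabulate (λ a → a))
      ≡⟨ sym (map-concatMap inject₁ (λ a → replicate (x (inject₁ a)) a) (tabulate (λ a → a))) ⟩
    map inject₁ (wordOf (x ∘ inject₁)) ∎

wordOf-zero : ∀ {k} (x : Fin k → ℕ) → (∀ i → x i ≡ 0) → wordOf x ≡ []
wordOf-zero {k} x x≡0 = blocks (tabulate (λ a → a))
  where
  blocks : (as : List (Fin k)) → concatMap (λ a → replicate (x a) a) as ≡ []
  blocks []       = refl
  blocks (a ∷ as) rewrite x≡0 a = blocks as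

wordOf-scaledUnit : ∀ m c → wordOf (scaledUnit c (fromℕ m)) ≡ replicate c (fromℕ m)
wordOf-scaledUnit m c = begin
  wordOf x                                             ≡⟨ wordOf-split m x ⟩
  map inject₁ (wordOf (x ∘ inject₁)) ++ replicate (x (fromℕ m)) (fromℕ m)
    ≡⟨ cong₂ (λ u v → map inject₁ u ++ replicate v (fromℕ m)) (wordOf-zero (x ∘ inject₁) off) on ⟩
  replicate c (fromℕ m)                                ∎
  where
  open ≡-Reasoning
  x = scaledUnit c (fromℕ m)
  off : ∀ i → x (inject₁ i) ≡ 0
  off i = trans (cong (λ b → c * (if b then 1 else 0)) (trans (isYes≗does d) (dec-false d (fromℕ≢inject₁ ∘ sym))))
                (*-zeroʳ c)
    where d = inject₁ i ≟ᶠ fromℕ m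
  on : x (fromℕ m) ≡ c
  on = trans (cong (λ b → c * (if b then 1 else 0)) (trans (isYes≗does d) (dec-true d refl))) (*-identityʳ c)
    where d = fromℕ m ≟ᶠ fromℕ m

module _ {k : ℕ} (M : Machine k) where
  open Machine M renaming (trans to step)

  runState-++ : ∀ q u v → runState M q (u ++ v) ≡ runState M (runState M q u) v
  runState-++ q []      v = refl
  runState-++ q (a ∷ u) v = runState-++ (step a q) u v

  runOut-++ : ∀ q u v → runOut M q (u ++ v) ≡ runOut M q u + runOut M (runState M q u) v
  runOut-++ q []      v = refl
  runOut-++ q (a ∷ u) v =
    trans (cong (out a q +_) (runOut-++ (step a q) u v)) (sym (+-assoc (out a q) _ _))

  runOut-pair : ∀ q a b → runOut M q (a ∷ b ∷ []) ≡ out a q + out b (step a q)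
  runOut-pair q a b = cong (out a q +_) (+-identityʳ (out b (step a q)))

tally : (k : ℕ) → Machine k
tally k = record { states = 1 ; trans = λ _ q → q ; out = λ _ _ → 1 }

runOut-tally : ∀ {k} q (w : List (Fin k)) → runOut (tally k) q w ≡ length w
runOut-tally q []      = refl
runOut-tally q (a ∷ w) = cong suc (runOut-tally q w)

-- The adder is the tally machine on two inputs, so it outputs a + b.
adder-sum : ∀ a b → computes adder zero (pair a b) ≡ a + b
adder-sum a b = begin
  runOut (tally 2) zero (left ++ (right ++ []))    ≡⟨ runOut-tally zero (left ++ (right ++ [])) ⟩
  length (left ++ (right ++ []))                   ≡⟨ length-++ left ⟩
  length left + length (right ++ [])               ≡⟨ cong (length left +_) (cong length (++-identityʳ right)) ⟩
  length left + length right                       ≡⟨ cong₂ _+_ (length-replicate a) (length-replicate b) ⟩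
  a + b ∎
  where
  open ≡-Reasoning
  left right : List (Fin 2)
  left  = replicate a zero
  right = replicate b (suc zero)

module Conservation {k k′ : ℕ} (M : Machine k) (N : Machine k′) (h : Fin k′ → Fin k) (L : ℕ)
  (π : Fin (Machine.states M) → Fin (Machine.states N))
  (φ : Fin (Machine.states M) → ℕ)
  (π-step : ∀ a q → π (Machine.trans M (h a) q) ≡ Machine.trans N a (π q))
  (φ-step : ∀ a q → L * Machine.out M (h a) q + φ (Machine.trans M (h a) q)
                    ≡ φ q + Machine.out N a (π q))
  where
  open Machine M using (out) renaming (trans to step)
  open Machine N using () renaming (trans to stepN; out to outN)

  π-run : ∀ q w → π (runState M q (map h w)) ≡ runState N (π q) w
  π-run q []      = refl
  π-run q (a ∷ w) = trans (π-run (step (h a) q) w) (cong (λ s → runState N s w) (π-step a q))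

  φ-run : ∀ q w → L * runOut M q (map h w) + φ (runState M q (map h w)) ≡ φ q + runOut N (π q) w
  φ-run q []      = trans (cong (_+ φ q) (*-zeroʳ L)) (sym (+-identityʳ (φ q)))
  φ-run q (a ∷ w) = begin
    L * (o + R) + φ q′                          ≡⟨ cong (_+ φ q′) (*-distribˡ-+ L o R) ⟩
    L * o + L * R + φ q′                        ≡⟨ +-assoc (L * o) (L * R) (φ q′) ⟩
    L * o + (L * R + φ q′)                      ≡⟨ cong (L * o +_) (φ-run (step (h a) q) w) ⟩
    L * o + (φ (step (h a) q) + runOut N (π (step (h a) q)) w)
                                                ≡⟨ sym (+-assoc (L * o) _ _) ⟩
    L * o + φ (step (h a) q) + runOut N (π (step (h a) q)) w
      ≡⟨ cong₂ _+_ (φ-step a q) (cong (λ s → runOut N s w) (π-step a q)) ⟩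
    φ q + outN a (π q) + runOut N (stepN a (π q)) w
                                                ≡⟨ +-assoc (φ q) _ _ ⟩
    φ q + runOut N (π q) (a ∷ w)                ∎
    where
    open ≡-Reasoning
    o = out (h a) q
    R = runOut M (step (h a) q) (map h w)
    q′ = runState M (step (h a) q) (map h w)

  module Abelian (σ : Fin (Machine.states N) → Fin (Machine.states M)) (πσ : ∀ s → π (σ s) ≡ s)
    (comm : ∀ i j q → step (h i) (step (h j) q) ≡ step (h j) (step (h i) q))
    (outComm : ∀ i j q → out (h i) q + out (h j) (step (h i) q) ≡ out (h j) q + out (h i) (step (h j) q))
    where

    N-comm : ∀ a b s → stepN a (stepN b s) ≡ stepN b (stepN a s)
    N-comm a b s = subst (λ s → stepN a (stepN b s) ≡ stepN b (stepN a s)) (πσ s) (begin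
      stepN a (stepN b (π q))        ≡⟨ sym (π-run q (b ∷ a ∷ [])) ⟩
      π (step (h a) (step (h b) q))  ≡⟨ cong π (comm a b q) ⟩
      π (step (h b) (step (h a) q))  ≡⟨ π-run q (a ∷ b ∷ []) ⟩
      stepN b (stepN a (π q))        ∎)
      where
      open ≡-Reasoning
      q = σ s

    N-outComm : ∀ a b s → outN a s + outN b (stepN a s) ≡ outN b s + outN a (stepN b s)
    N-outComm a b s =
      subst (λ s → outN a s + outN b (stepN a s) ≡ outN b s + outN a (stepN b s)) (πσ s)
        (+-cancelˡ-≡ (φ q) _ _ (begin
          φ q + (outN a (π q) + outN b (stepN a (π q)))
            ≡⟨ cong (φ q +_) (sym (runOut-pair N (π q) a b)) ⟩
          φ q + runOut N (π q) (a ∷ b ∷ [])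
            ≡⟨ sym (φ-run q (a ∷ b ∷ [])) ⟩
          L * runOut M q (h a ∷ h b ∷ []) + φ (step (h b) (step (h a) q))
            ≡⟨ cong₂ (λ u v → L * u + φ v) swapOut (comm b a q) ⟩
          L * runOut M q (h b ∷ h a ∷ []) + φ (step (h a) (step (h b) q))
            ≡⟨ φ-run q (b ∷ a ∷ []) ⟩
          φ q + runOut N (π q) (b ∷ a ∷ [])
            ≡⟨ cong (φ q +_) (runOut-pair N (π q) b a) ⟩
          φ q + (outN b (π q) + outN a (stepN b (π q))) ∎))
      where
      open ≡-Reasoning
      q = σ s
      swapOut : runOut M q (h a ∷ h b ∷ []) ≡ runOut M q (h b ∷ h a ∷ [])
      swapOut = trans (runOut-pair M q (h a) (h b))
                      (trans (outComm a b q) (sym (runOut-pair M q (h b) (h a))))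

-- The case N = tally: a letter that raises L·(output) + φ by exactly one
-- raises it by n along n copies of itself.
unit-conservation : ∀ {k} (M : Machine k) (a : Fin k) (L : ℕ) (φ : Fin (Machine.states M) → ℕ)
  → (∀ q → L * Machine.out M a q + φ (Machine.trans M a q) ≡ φ q + 1)
  → ∀ n q → L * runOut M q (replicate n a) + φ (runState M q (replicate n a)) ≡ φ q + n
unit-conservation M a L φ step n q =
  subst (λ w → L * runOut M q w + φ (runState M q w) ≡ φ q + n) (map-replicate (λ _ → a) n zero)
    (trans (Conservation.φ-run M (tally 1) (λ _ → a) L (λ _ → zero) φ (λ _ _ → refl) (λ _ → step)
              q (replicate n zero))
           (cong (φ q +_) (trans (runOut-tally zero (replicate n zero)) (length-replicate n))))

toppler-step : ∀ l (s : Fin (suc l))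
  → suc l * (if toℕ s ≡ᵇ l then 1 else 0) + toℕ (fromℕ< (m%n<n (suc (toℕ s)) (suc l))) ≡ toℕ s + 1
toppler-step l s rewrite toℕ-fromℕ< (m%n<n (suc (toℕ s)) (suc l)) with toℕ s ≡ᵇ l in eq
... | true  = begin
  suc l * 1 + suc (toℕ s) % suc l  ≡⟨ cong (λ n → suc l * 1 + suc n % suc l) s≡l ⟩
  suc l * 1 + suc l % suc l        ≡⟨ cong₂ _+_ (*-identityʳ (suc l)) (n%n≡0 (suc l)) ⟩
  suc l + 0                        ≡⟨ trans (+-identityʳ (suc l)) (+-comm 1 l) ⟩
  l + 1                            ≡⟨ cong (_+ 1) (sym s≡l) ⟩
  toℕ s + 1                        ∎
  where
  open ≡-Reasoning
  s≡l : toℕ s ≡ l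
  s≡l = ≡ᵇ⇒≡ (toℕ s) l (subst T (sym eq) tt)
... | false = begin
  suc l * 0 + suc (toℕ s) % suc l  ≡⟨ cong₂ _+_ (*-zeroʳ (suc l)) (m<n⇒m%n≡m (s≤s s<l)) ⟩
  suc (toℕ s)                      ≡⟨ +-comm 1 (toℕ s) ⟩
  toℕ s + 1                        ∎
  where
  open ≡-Reasoning
  s<l : toℕ s < l
  s<l = ≤∧≢⇒< (toℕ≤pred[n] s) (λ s≡l → subst T eq (≡⇒≡ᵇ (toℕ s) l s≡l))

toppler-div : ∀ l (s : Fin (suc l)) n → computes (toppler l) s (λ _ → n) ≡ (toℕ s + n) / suc l
toppler-div l s n = begin
  runOut (toppler l) s (replicate n zero ++ [])
    ≡⟨ cong (runOut (toppler l) s) (++-identityʳ (replicate n zero)) ⟩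
  runOut (toppler l) s (replicate n zero)
    ≡⟨ sym (div-exact (suc l) _ _ (toℕ<n (runState (toppler l) s (replicate n zero)))) ⟩
  (suc l * runOut (toppler l) s (replicate n zero) + toℕ (runState (toppler l) s (replicate n zero))) / suc l
    ≡⟨ cong (_/ suc l) (unit-conservation (toppler l) zero (suc l) toℕ (toppler-step l) n s) ⟩
  (toℕ s + n) / suc l ∎
  where open ≡-Reasoning

record Enumeration (N : ℕ) (R : Fin N → Bool) : Set where
  field
    size       : ℕ
    elem       : Fin size → Fin N
    index      : (q : Fin N) → T (R q) → Fin size
    elem-index : ∀ q p → elem (index q p) ≡ q
    index-elem : ∀ a p → index (elem a) p ≡ a
    elem-sat   : ∀ a → T (R (elem a))

private
  consYes : ∀ {N} {R : Fin (suc N) → Bool} → T (R zero) → Enumeration N (R ∘ suc) → Enumeration (suc N) R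
  consYes {N} {R} r E = record
    { size = suc size ; elem = e ; index = i ; elem-index = ei ; index-elem = ie ; elem-sat = es }
    where
    open Enumeration E
    e : Fin (suc size) → Fin (suc N)
    e zero    = zero
    e (suc a) = suc (elem a)
    i : (q : Fin (suc N)) → T (R q) → Fin (suc size)
    i zero    _ = zero
    i (suc q) p = suc (index q p)
    ei : ∀ q p → e (i q p) ≡ q
    ei zero    _ = refl
    ei (suc q) p = cong suc (elem-index q p)
    ie : ∀ a p → i (e a) p ≡ a
    ie zero    _ = refl
    ie (suc a) p = cong suc (index-elem a p)
    es : ∀ a → T (R (e a))
    es zero    = r
    es (suc a) = elem-sat a

  consNo : ∀ {N} {R : Fin (suc N) → Bool} → ¬ T (R zero) → Enumeration N (R ∘ suc) → Enumeration (suc N) R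
  consNo {N} {R} ¬r E = record
    { size = size ; elem = suc ∘ elem ; index = i ; elem-index = ei ; index-elem = index-elem ; elem-sat = elem-sat }
    where
    open Enumeration E
    i : (q : Fin (suc N)) → T (R q) → Fin size
    i zero    p = ⊥-elim (¬r p)
    i (suc q) p = index q p
    ei : ∀ q p → suc (elem (i q p)) ≡ q
    ei zero    p = ⊥-elim (¬r p)
    ei (suc q) p = cong suc (elem-index q p)

enumerate : ∀ N (R : Fin N → Bool) → Enumeration N R
enumerate zero    R = record
  { size = 0 ; elem = λ () ; index = λ () ; elem-index = λ () ; index-elem = λ () ; elem-sat = λ () }
enumerate (suc N) R with T? (R zero)
... | yes r = consYes r (enumerate N (R ∘ suc))
... | no ¬r = consNo ¬r (enumerate N (R ∘ suc))

module _ {k : ℕ} (P : AbelianProcessor k) where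
  open AbelianProcessor P
  open Machine machine renaming (trans to step)

  step-run : ∀ i q w → step i (runState machine q w) ≡ runState machine (step i q) w
  step-run i q []      = refl
  step-run i q (a ∷ w) =
    trans (step-run i (step a q) w) (cong (λ s → runState machine s w) (comm i a q))

  out-run : ∀ i q w → out i q + runOut machine (step i q) w
                      ≡ runOut machine q w + out i (runState machine q w)
  out-run i q []      = +-comm (out i q) 0
  out-run i q (a ∷ w) = begin
    out i q + (out a (step i q) + runOut machine (step a (step i q)) w)
      ≡⟨ sym (+-assoc (out i q) _ _) ⟩
    out i q + out a (step i q) + runOut machine (step a (step i q)) w
      ≡⟨ cong₂ _+_ (outComm i a q) (cong (λ s → runOut machine s w) (comm a i q)) ⟩
    out a q + out i (step a q) + runOut machine (step i (step a q)) w
      ≡⟨ +-assoc (out a q) _ _ ⟩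
    out a q + (out i (step a q) + runOut machine (step i (step a q)) w)
      ≡⟨ cong (out a q +_) (out-run i (step a q) w) ⟩
    out a q + (runOut machine (step a q) w + out i (runState machine (step a q) w))
      ≡⟨ sym (+-assoc (out a q) _ _) ⟩
    runOut machine q (a ∷ w) + out i (runState machine q (a ∷ w)) ∎
    where open ≡-Reasoning

module LastLetter {m : ℕ} (P : AbelianProcessor (suc m)) (l : ℕ)
  (periodic : ActsTrivially P (suc l)) (meager : Meager P (suc l)) where
  open AbelianProcessor P
  open Machine machine renaming (trans to step)

  K : Fin (suc m)
  K = fromℕ m

  L : ℕ
  L = suc l

  K^_ : ℕ → List (Fin (suc m))
  K^ n = replicate n K

  run : Fin states → List (Fin (suc m)) → Fin states
  run = runState machine

  emit : Fin states → List (Fin (suc m)) → ℕ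
  emit = runOut machine

  run-K+ : ∀ q a b → run q (K^ (a + b)) ≡ run (run q (K^ a)) (K^ b)
  run-K+ q a b = trans (cong (run q) (replicate-+ a b K)) (runState-++ machine q (K^ a) (K^ b))

  emit-K+ : ∀ q a b → emit q (K^ (a + b)) ≡ emit q (K^ a) + emit (run q (K^ a)) (K^ b)
  emit-K+ q a b = trans (cong (emit q) (replicate-+ a b K)) (runOut-++ machine q (K^ a) (K^ b))

  run-period : ∀ j q → run q (K^ (j * L)) ≡ q
  run-period zero    q = refl
  run-period (suc j) q =
    trans (run-K+ q L (j * L)) (trans (cong (λ s → run s (K^ (j * L))) (periodic q)) (run-period j q))

  -- Every state emits exactly one letter on K^L: this holds at the start by
  -- meagerness, and the output on K^L is unchanged by any letter because
  -- K^L acts trivially.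
  emit-period : ∀ q → emit q (K^ L) ≡ 1
  emit-period q = trans (invariant-run start (proj₁ (reach q)) q (proj₂ (reach q))) at-start
    where
    at-start : emit start (K^ L) ≡ 1
    at-start = trans (cong (emit start) (sym (wordOf-scaledUnit m L))) meager
    invariant : ∀ a q → emit (step a q) (K^ L) ≡ emit q (K^ L)
    invariant a q = +-cancelˡ-≡ (out a q) _ _ (begin
      out a q + emit (step a q) (K^ L)        ≡⟨ out-run P a q (K^ L) ⟩
      emit q (K^ L) + out a (run q (K^ L))    ≡⟨ cong (λ s → emit q (K^ L) + out a s) (periodic q) ⟩
      emit q (K^ L) + out a q                 ≡⟨ +-comm (emit q (K^ L)) (out a q) ⟩
      out a q + emit q (K^ L)                 ∎)
      where open ≡-Reasoning
    invariant-run : ∀ q w q′ → run q w ≡ q′ → emit q′ (K^ L) ≡ emit q (K^ L)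
    invariant-run q []      q′ refl = refl
    invariant-run q (a ∷ w) q′ eq   = trans (invariant-run (step a q) w q′ eq) (invariant a q)

  -- The potential of q: c(q) = Σ_{1 ≤ j ≤ l} (output of K^j from q).  It is the
  -- number of letters the state q "holds" towards the next output on K.
  partial : ℕ → Fin states → ℕ
  partial zero    q = 0
  partial (suc n) q = emit q (K^ (suc n)) + partial n q

  potential : Fin states → ℕ
  potential = partial l

  -- Peeling the first letter K off every block K^j.
  partial-shift : ∀ n q → partial (suc n) q ≡ suc n * out K q + partial n (step K q)
  partial-shift zero    q = refl
  partial-shift (suc n) q = begin
    (o + E) + partial (suc n) q              ≡⟨ cong ((o + E) +_) (partial-shift n q) ⟩
    (o + E) + (suc n * o + partial n q′)     ≡⟨ interchange o E (suc n * o) (partial n q′) ⟩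
    (o + suc n * o) + (E + partial n q′)     ∎
    where
    open ≡-Reasoning
    o = out K q
    q′ = step K q
    E = emit q′ (K^ (suc n))

  potential-step : ∀ q → L * out K q + potential (step K q) ≡ potential q + 1
  potential-step q = begin
    L * out K q + potential (step K q)   ≡⟨ sym (partial-shift l q) ⟩
    emit q (K^ L) + potential q          ≡⟨ cong (_+ potential q) (emit-period q) ⟩
    1 + potential q                      ≡⟨ +-comm 1 (potential q) ⟩
    potential q + 1                      ∎
    where open ≡-Reasoning

  K-conservation : ∀ n q → L * emit q (K^ n) + potential (run q (K^ n)) ≡ potential q + n
  K-conservation = unit-conservation machine K L potential potential-step

  -- Each summand of the potential is at most one, so c(q) ≤ l < L.
  potential-bound : ∀ q → potential q < L
  potential-bound q = s≤s (partial-bound l (n≤1+n l))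
    where
    emit-prefix : ∀ j → j ≤ L → emit q (K^ j) ≤ 1
    emit-prefix j j≤L = begin
      emit q (K^ j)                                          ≤⟨ m≤m+n _ _ ⟩
      emit q (K^ j) + emit (run q (K^ j)) (K^ (L ∸ j))       ≡⟨ sym (emit-K+ q j (L ∸ j)) ⟩
      emit q (K^ (j + (L ∸ j)))                              ≡⟨ cong (λ n → emit q (K^ n)) (m+[n∸m]≡n j≤L) ⟩
      emit q (K^ L)                                          ≡⟨ emit-period q ⟩
      1                                                      ∎
      where open ≤-Reasoning
    partial-bound : ∀ n → n ≤ L → partial n q ≤ n
    partial-bound zero    _   = z≤n
    partial-bound (suc n) n<L = +-mono-≤ (emit-prefix (suc n) n<L) (partial-bound n (≤-trans (n≤1+n n) n<L))

  -- The representative of q: the state reached by feeding K until the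
  -- potential drops to zero (which happens with the next output letter).
  rep : Fin states → Fin states
  rep q = run q (K^ (L ∸ potential q))

  -- The block K^(L - c q) emits exactly one letter and leaves potential zero.
  rep-potential : ∀ q → potential (rep q) ≡ 0
  rep-potential q = +-cancelˡ-≡ (L * 1) _ _ (trans (cong (λ e → L * e + potential (rep q)) (sym one)) balance)
    where
    balance : L * emit q (K^ (L ∸ potential q)) + potential (rep q) ≡ L * 1 + 0
    balance = trans (K-conservation (L ∸ potential q) q)
                    (trans (m+[n∸m]≡n (<⇒≤ (potential-bound q))) (sym (trans (+-identityʳ _) (*-identityʳ L))))
    one : emit q (K^ (L ∸ potential q)) ≡ 1
    one = quotient-unique L (potential-bound (rep q)) (s≤s z≤n) balance

  rep-fixed : ∀ q → potential q ≡ 0 → rep q ≡ q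
  rep-fixed q c≡0 = trans (cong (λ c → run q (K^ (L ∸ c))) c≡0) (periodic q)

  -- Feeding K does not change the representative: the detour differs from
  -- the direct route by a whole number of periods K^L.
  rep-K : ∀ n q → rep (run q (K^ n)) ≡ rep q
  rep-K n q = begin
    run q′ (K^ (L ∸ potential q′))         ≡⟨ sym (run-K+ q n _) ⟩
    run q (K^ (n + (L ∸ potential q′)))    ≡⟨ cong (λ j → run q (K^ j)) realigned ⟩
    run q (K^ ((L ∸ potential q) + E * L)) ≡⟨ run-K+ q (L ∸ potential q) (E * L) ⟩
    run (rep q) (K^ (E * L))               ≡⟨ run-period E (rep q) ⟩
    rep q                                  ∎
    where
    open ≡-Reasoning
    q′ = run q (K^ n)
    E = emit q (K^ n)
    realigned : n + (L ∸ potential q′) ≡ (L ∸ potential q) + E * L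
    realigned = realign L E (potential q) (potential q′) n _ _
      (m+[n∸m]≡n (<⇒≤ (potential-bound q′))) (m+[n∸m]≡n (<⇒≤ (potential-bound q))) (K-conservation n q)

  rep-step : ∀ i q → rep (step i (rep q)) ≡ rep (step i q)
  rep-step i q = trans (cong rep (step-run P i q (K^ (L ∸ potential q)))) (rep-K (L ∸ potential q) (step i q))

  -- The excess of letter i at q: L·o_i(q) + c(t_i q), the letter count that i
  -- contributes to the total once the potential of q is taken into account.
  excess : Fin (suc m) → Fin states → ℕ
  excess i q = L * out i q + potential (step i q)

  excess-K : ∀ i n q → excess i q + potential (run q (K^ n)) ≡ potential q + excess i (run q (K^ n))
  excess-K i n q = excess-balance L (out i q) (out i q′) (emit q (K^ n)) (emit (step i q) (K^ n))
    (potential (step i q)) (potential (step i q′)) (potential q) (potential q′) n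
    (out-run P i q (K^ n))
    (trans (cong (λ s → L * emit (step i q) (K^ n) + potential s) (step-run P i q (K^ n)))
           (K-conservation n (step i q)))
    (K-conservation n q)
    where q′ = run q (K^ n)

  excess-rep : ∀ i q → excess i q ≡ potential q + excess i (rep q)
  excess-rep i q = trans (sym (trans (cong (excess i q +_) (rep-potential q)) (+-identityʳ _)))
                         (excess-K i (L ∸ potential q) q)

  isRep : Fin states → Bool
  isRep q = potential q ≡ᵇ 0

  private module Reps = Enumeration (enumerate states isRep)

  rep-isRep : ∀ q → T (isRep (rep q))
  rep-isRep q = ≡⇒≡ᵇ (potential (rep q)) 0 (rep-potential q)

  class : Fin states → Fin Reps.size
  class q = Reps.index (rep q) (rep-isRep q)

  elem-class : ∀ q → Reps.elem (class q) ≡ rep q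
  elem-class q = Reps.elem-index (rep q) (rep-isRep q)

  index-unique : ∀ q p a → Reps.elem a ≡ q → Reps.index q p ≡ a
  index-unique _ p a refl = Reps.index-elem a p

  class-rep : ∀ q q′ → rep q ≡ rep q′ → class q ≡ class q′
  class-rep q q′ eq = index-unique (rep q) (rep-isRep q) (class q′) (trans (elem-class q′) (sym eq))

  class-elem : ∀ a → class (Reps.elem a) ≡ a
  class-elem a = index-unique _ _ a (sym (rep-fixed (Reps.elem a) (≡ᵇ⇒≡ _ 0 (Reps.elem-sat a))))

  quotient : Machine m
  quotient = record
    { states = Reps.size
    ; trans  = λ i a → class (step (inject₁ i) (Reps.elem a))
    ; out    = λ i a → excess (inject₁ i) (Reps.elem a)
    }

  class-K : ∀ q → class (step K q) ≡ class q
  class-K q = class-rep (step K q) q (rep-K 1 q)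

  class-step : ∀ i q → class (step (inject₁ i) q) ≡ Machine.trans quotient i (class q)
  class-step i q = sym (trans (cong (λ s → class (step (inject₁ i) s)) (elem-class q))
                              (class-rep (step (inject₁ i) (rep q)) (step (inject₁ i) q) (rep-step (inject₁ i) q)))

  excess-step : ∀ i q → L * out (inject₁ i) q + potential (step (inject₁ i) q)
                        ≡ potential q + Machine.out quotient i (class q)
  excess-step i q = trans (excess-rep (inject₁ i) q)
                          (cong (λ s → potential q + excess (inject₁ i) s) (sym (elem-class q)))

  module Link = Conservation machine quotient inject₁ L class potential class-step excess-step
  open Link.Abelian Reps.elem class-elem (λ i j → comm (inject₁ i) (inject₁ j))
                                         (λ i j → outComm (inject₁ i) (inject₁ j))

  keep : {a : Fin (suc m)} → View a → List (Fin m)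
  keep ‵fromℕ       = []
  keep (‵inject₁ i) = i ∷ []

  dropK : List (Fin (suc m)) → List (Fin m)
  dropK []      = []
  dropK (a ∷ w) = keep (view a) ++ dropK w

  class-letter : ∀ {a} (v : View a) q → class (step a q) ≡ runState quotient (class q) (keep v)
  class-letter ‵fromℕ       q = class-K q
  class-letter (‵inject₁ i) q = class-step i q

  class-run : ∀ q w → class (run q w) ≡ runState quotient (class q) (dropK w)
  class-run q []      = refl
  class-run q (a ∷ w) = begin
    class (run (step a q) w)                           ≡⟨ class-run (step a q) w ⟩
    runState quotient (class (step a q)) (dropK w)
      ≡⟨ cong (λ s → runState quotient s (dropK w)) (class-letter (view a) q) ⟩
    runState quotient (runState quotient (class q) (keep (view a))) (dropK w)
      ≡⟨ sym (runState-++ quotient (class q) (keep (view a)) (dropK w)) ⟩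
    runState quotient (class q) (dropK (a ∷ w))        ∎
    where open ≡-Reasoning

  reach-class : ∀ q a → ∃ (λ w → run q w ≡ Reps.elem a) → ∃ λ w → runState quotient (class q) w ≡ a
  reach-class q a (w , eq) = dropK w , trans (sym (class-run q w)) (trans (cong class eq) (class-elem a))

  Q : AbelianProcessor m
  Q = record
    { machine = quotient
    ; start   = class start
    ; comm    = N-comm
    ; outComm = N-outComm
    ; reach   = λ a → reach-class start a (reach (Reps.elem a))
    }

  Q-recurrent : Recurrent P → Recurrent Q
  Q-recurrent recurrent a b =
    subst (λ s → ∃ λ w → runState quotient s w ≡ b) (class-elem a)
          (reach-class (Reps.elem a) b (recurrent (Reps.elem a) (Reps.elem b)))

  primer : Fin (suc l)
  primer = fromℕ< (potential-bound start)

  -- On input x = (x′, x_K):  L·f_P(x) + c(final state) = c(start) + f_Q(x′) + x_K,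
  -- and c(final state) < L, so f_P(x) = ⌊(c(start) + f_Q(x′) + x_K)/L⌋, which is
  -- what the network outputs.
  emulation : ∀ x → fP P x ≡ networkFun Q l primer x
  emulation x = begin
    fP P x                                       ≡⟨ cong (emit start) (wordOf-split m x) ⟩
    emit start (map inject₁ w′ ++ K^ xK)         ≡⟨ runOut-++ machine start (map inject₁ w′) (K^ xK) ⟩
    A + B                                        ≡⟨ sym (div-exact L (A + B) (potential q₂) (potential-bound q₂)) ⟩
    (L * (A + B) + potential q₂) / L             ≡⟨ cong (_/ L) total ⟩
    (potential start + (fP Q x′ + xK)) / L
      ≡⟨ cong₂ (λ s n → (s + n) / L) (sym (toℕ-fromℕ< (potential-bound start))) (sym (adder-sum (fP Q x′) xK)) ⟩
    (toℕ primer + computes adder zero (pair (fP Q x′) xK)) / L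
                                                 ≡⟨ sym (toppler-div l primer _) ⟩
    networkFun Q l primer x                      ∎
    where
    open ≡-Reasoning
    x′ = x ∘ inject₁
    xK = x K
    w′ = wordOf x′
    q₁ = run start (map inject₁ w′)
    q₂ = run q₁ (K^ xK)
    A = emit start (map inject₁ w′)
    B = emit q₁ (K^ xK)
    total : L * (A + B) + potential q₂ ≡ potential start + (fP Q x′ + xK)
    total = begin
      L * (A + B) + potential q₂        ≡⟨ cong (_+ potential q₂) (*-distribˡ-+ L A B) ⟩
      L * A + L * B + potential q₂      ≡⟨ +-assoc (L * A) (L * B) (potential q₂) ⟩
      L * A + (L * B + potential q₂)    ≡⟨ cong (L * A +_) (K-conservation xK q₁) ⟩
      L * A + (potential q₁ + xK)       ≡⟨ sym (+-assoc (L * A) (potential q₁) xK) ⟩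
      L * A + potential q₁ + xK         ≡⟨ cong (_+ xK) (Link.φ-run start w′) ⟩
      potential start + fP Q x′ + xK    ≡⟨ +-assoc (potential start) (fP Q x′) xK ⟩
      potential start + (fP Q x′ + xK)  ∎

-- Lemma 4.5.

lemma4p5 : (m : ℕ) (P : AbelianProcessor (suc m)) (l : ℕ)
    → Recurrent P
    → IsLambdaK P (suc l)
    → Meager P (suc l)
    → (∀ x → fP P (addScaledUnit x (suc l) (fromℕ m)) ≡ fP P x + 1)
    → Σ (AbelianProcessor m) λ Q → Recurrent Q × ∃ λ (s : Fin (suc l))
    → ∀ x → fP P x ≡ networkFun Q l s x
lemma4p5 m P l recurrent (_ , periodic , _) meager _ =
  Q , Q-recurrent recurrent , primer , emulation
  where open LastLetter P l periodic meager
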